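{- Let $G=(A\cup B,E)$ be a bipartite graph in which every node has a strict ranking of its neighbors and which admits a perfect matching; let $n_0=|A|=|B|$. Let $M$ be a popular perfect matching in $G$ (a perfect matching with $\Delta(M,N)\ge0$ for every perfect matching $N$), and let $\vec\alpha$ be an optimal solution of the linear program $\min\sum_{u\in A\cup B}y_u$ s.t. $y_a+y_b\ge\mathsf{wt}_M(a,b)$ for all $(a,b)\in E$, with $\alpha_a\in\{0,-2,\ldots,-2(n_0-1)\}$ for all $a\in A$ and $\alpha_b\in\{0,2,\ldots,2(n_0-1)\}$ for all $b\in B$. Define the matching $S$ of $G^*$ as $$S=\bigcup_{i=0}^{n_0-1}\{(a_i,\tilde b): (a,b)\in M,\ \alpha_a=-2i,\ \alpha_b=2i\}\ \cup\ D,$$ where $D$ consists, for each $a\in A$ with $\alpha_a=-2i$, of the edges $(a_j,d_{j+1}(a))$ for $0\le j\le i-1$ and $(a_j,d_j(a))$ for $i+1\le j\le n_0-1$. Then $S$ is a stable matching in $G^*$.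
   Context: Node $u$ prefers matching $M$ to $N$ if $u$ is matched in $M$ and unmatched in $N$, or matched in both and prefers its partner in $M$. $\phi(M,N)$ is the number of nodes preferring $M$ to $N$, $\Delta(M,N)=\phi(M,N)-\phi(N,M)$. An edge $(u,v)$ blocks a matching if each of $u,v$ is unmatched or prefers the other to its partner; a matching is stable if no edge blocks it. $\mathsf{wt}_M(a,b)=2$ if $(a,b)$ blocks $M$; $-2$ if $a$ and $b$ both prefer their assignments in $M$ to each other; $0$ otherwise. The instance $G^*=(A^*\cup B^*,E^*)$ (with $n_0=|A|$): $A^*=\{a_i:a\in A,0\le i\le n_0-1\}$; $B^*=\{\tilde b:b\in B\}\cup\{d_i(a):a\in A,1\le i\le n_0-1\}$. $E^*$ contains $(a_i,\tilde b)$ for $(a,b)\in E$, $0\le i\le n_0-1$, and $(a_{i-1},d_i(a)),(a_i,d_i(a))$ for $a\in A$, $1\le i\le n_0-1$. If $a$ ranks $b_1\succ\cdots\succ b_k$ in $G$: $a_0$ ranks $\tilde b_1\succ\cdots\succ\tilde b_k\succ d_1(a)$; $a_i$ ($1\le i\le n_0-2$) ranks $d_i(a)\succ\tilde b_1\succ\cdots\succ\tilde b_k\succ d_{i+1}(a)$; $a_{n_0-1}$ ranks $d_{n_0-1}(a)\succ\tilde b_1\succ\cdots\succ\tilde b_k$ (if $n_0=1$, $a_0$ ranks $\tilde b_1\succ\cdots\succ\tilde b_k$). $d_i(a)$ ranks $a_{i-1}\succ a_i$. $\tilde b$ ranks all subscript-$(n_0-1)$ neighbors first, then subscript $n_0-2$,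 ..., subscript $0$ last; within subscript $i$, $\tilde b$ prefers $z_i$ to $z'_i$ iff $b$ prefers $z$ to $z'$ in $G$. -}

module Defs where

open import Data.Nat as ℕ using (ℕ; zero; suc; _<_; _∸_; _<?_)
open import Data.Fin using (Fin; toℕ) renaming (zero to fzero; suc to fsuc)
open import Data.List using (length; filter; allFin)
open import Data.Bool using (Bool; true; false; if_then_else_; _∧_)
open import Data.Integer using (+_)
open import Data.Rational as ℚ using (ℚ; _/_; 0ℚ)
open import Data.Product using (Σ; _×_; _,_)
open import Data.Sum using (_⊎_)
open import Data.Empty using (⊥)
open import Relation.Nullary using (¬_)
open import Relation.Nullary.Decidable using (⌊_⌋)
open import Relation.Binary.PropositionalEquality using (_≡_)

-- The instance G = (A ∪ B, E) with A = B = Fin n (so n₀ = n).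
-- Strict rankings are given by rank functions (smaller = better),
-- injective on the neighbourhood of every node.

record Graph (n : ℕ) : Set₁ where
  field
    E     : Fin n → Fin n → Set
    rankA : Fin n → Fin n → ℕ
    rankB : Fin n → Fin n → ℕ
    strictA : ∀ a b b′ → E a b → E a b′ → rankA a b ≡ rankA a b′ → b ≡ b′
    strictB : ∀ b a a′ → E a b → E a′ b → rankB b a ≡ rankB b a′ → a ≡ a′

module _ {n : ℕ} (G : Graph n) where
  open Graph G

  record PerfectMatching : Set where
    field
      mA : Fin n → Fin n
      mB : Fin n → Fin n
      mBA : ∀ a → mB (mA a) ≡ a
      mAB : ∀ b → mA (mB b) ≡ b
      inE : ∀ a → E a (mA a)
  open PerfectMatching public

  -- φ(M , N): number of nodes preferring M to N (both perfect: every node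
  -- is matched in both, so u prefers M iff it strictly prefers its M-partner)
  φ : PerfectMatching → PerfectMatching → ℕ
  φ M N = length (filter (λ a → rankA a (mA M a) <? rankA a (mA N a)) (allFin n))
          ℕ.+ length (filter (λ b → rankB b (mB M b) <? rankB b (mB N b)) (allFin n))

  Popular : PerfectMatching → Set
  Popular M = ∀ (N : PerfectMatching) → φ N M ℕ.≤ φ M N

  wt : PerfectMatching → Fin n → Fin n → ℚ
  wt M a b =
    if ⌊ rankA a b <? rankA a (mA M a) ⌋ ∧ ⌊ rankB b a <? rankB b (mB M b) ⌋
    then + 2 / 1
    else (if ⌊ rankA a (mA M a) <? rankA a b ⌋ ∧ ⌊ rankB b (mB M b) <? rankB b a ⌋
          then ℚ.- (+ 2 / 1)
          else 0ℚ)

  sumℚ : ∀ {k} → (Fin k → ℚ) → ℚ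
  sumℚ {zero} f = 0ℚ
  sumℚ {suc k} f = f fzero ℚ.+ sumℚ (λ i → f (fsuc i))

  Feasible : PerfectMatching → (Fin n → ℚ) → (Fin n → ℚ) → Set
  Feasible M yA yB = ∀ a b → E a b → wt M a b ℚ.≤ yA a ℚ.+ yB b

  Objective : (Fin n → ℚ) → (Fin n → ℚ) → ℚ
  Objective yA yB = sumℚ yA ℚ.+ sumℚ yB

  OptimalLP : PerfectMatching → (Fin n → ℚ) → (Fin n → ℚ) → Set
  OptimalLP M yA yB =
    Feasible M yA yB ×
    (∀ zA zB → Feasible M zA zB → Objective yA yB ℚ.≤ Objective zA zB)

  -- The instance G* .
  -- A* node  (a , i)  is  a_i  (0 ≤ i ≤ n-1).
  -- B* nodes: tl b  is  b̃ ;  d a k  (k : Fin (n ∸ 1))  is  d_{k+1}(a).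

  AStar : Set
  AStar = Fin n × Fin n

  data BStar : Set where
    tl : Fin n → BStar
    d  : Fin n → Fin (n ∸ 1) → BStar

  data EStar : AStar → BStar → Set where
    e-tl : ∀ {a b} (i : Fin n) → E a b → EStar (a , i) (tl b)
    -- (a_{i-1}, d_i(a)) : a_k with d_{k+1}(a)
    e-dl : ∀ a (i : Fin n) (k : Fin (n ∸ 1)) → toℕ i ≡ toℕ k → EStar (a , i) (d a k)
    -- (a_i, d_i(a)) : a_{k+1} with d_{k+1}(a)
    e-dr : ∀ a (i : Fin n) (k : Fin (n ∸ 1)) → toℕ i ≡ suc (toℕ k) → EStar (a , i) (d a k)

  -- PrefA x y z : node x ∈ A* prefers y to z
  -- a_i : d_i(a) ≻ b̃₁ ≻ … ≻ b̃_k ≻ d_{i+1}(a)   (missing d's omitted)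
  data PrefA : AStar → BStar → BStar → Set where
    p-top-tl : ∀ {a i b} (k : Fin (n ∸ 1)) → toℕ i ≡ suc (toℕ k) →
               PrefA (a , i) (d a k) (tl b)
    p-top-bot : ∀ {a i} (k k′ : Fin (n ∸ 1)) → toℕ i ≡ suc (toℕ k) → toℕ i ≡ toℕ k′ →
                PrefA (a , i) (d a k) (d a k′)
    p-tl-tl : ∀ {a i b b′} → rankA a b < rankA a b′ → PrefA (a , i) (tl b) (tl b′)
    p-tl-bot : ∀ {a i b} (k′ : Fin (n ∸ 1)) → toℕ i ≡ toℕ k′ →
               PrefA (a , i) (tl b) (d a k′)

  data PrefB : BStar → AStar → AStar → Set where
    p-sub  : ∀ {b a a′ i j} → toℕ j < toℕ i → PrefB (tl b) (a , i) (a′ , j)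
    p-same : ∀ {b a a′ i} → rankB b a < rankB b a′ → PrefB (tl b) (a , i) (a′ , i)
    p-d : ∀ {a k i j} → toℕ i ≡ toℕ k → toℕ j ≡ suc (toℕ k) →
          PrefB (d a k) (a , i) (a , j)

  IsMatchingStar : (AStar → BStar → Set) → Set
  IsMatchingStar S =
    (∀ x y → S x y → EStar x y) ×
    (∀ x y y′ → S x y → S x y′ → y ≡ y′) ×
    (∀ x x′ y → S x y → S x′ y → x ≡ x′)

  BlocksStar : (AStar → BStar → Set) → AStar → BStar → Set
  BlocksStar S x y =
    EStar x y ×
    ((∀ z → ¬ S x z) ⊎ Σ BStar (λ z → S x z × PrefA x y z)) ×
    ((∀ w → ¬ S w y) ⊎ Σ AStar (λ w → S w y × PrefB y x w))

  StableStar : (AStar → BStar → Set) → Set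
  StableStar S = IsMatchingStar S × (∀ x y → ¬ BlocksStar S x y)

  -- The matching S, given M and the integer data  α_a = -2·ia(a),
  -- α_b = 2·jb(b).
  data SMatch (M : PerfectMatching) (ia jb : Fin n → Fin n) : AStar → BStar → Set where
    s-M  : ∀ {a b i} → mA M a ≡ b → ia a ≡ i → jb b ≡ i → SMatch M ia jb (a , i) (tl b)
    -- (a_j , d_{j+1}(a)) for 0 ≤ j ≤ ia a - 1
    s-D1 : ∀ {a j} (k : Fin (n ∸ 1)) → toℕ j ≡ toℕ k → toℕ j < toℕ (ia a) →
           SMatch M ia jb (a , j) (d a k)
    -- (a_j , d_j(a)) for ia a + 1 ≤ j ≤ n-1
    s-D2 : ∀ {a j} (k : Fin (n ∸ 1)) → toℕ j ≡ suc (toℕ k) → toℕ (ia a) < toℕ j →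
           SMatch M ia jb (a , j) (d a k)

  αA : (Fin n → Fin n) → Fin n → ℚ
  αA ia a = ℚ.- (+ (2 ℕ.* toℕ (ia a)) / 1)

  αB : (Fin n → Fin n) → Fin n → ℚ
  αB jb b = + (2 ℕ.* toℕ (jb b)) / 1

-- Let the exchange graph of M have the vertex set A and an arc a → a′ of weight wt_M(a, M a′)
-- whenever (a, M a′) ∈ E.  Rotating M along a cycle of this graph yields a perfect matching N
-- with Δ(N, M) equal to the weight of the cycle, so popularity rules out positive cycles, and
-- the weights of heaviest simple paths form a potential p.  Then y_a = -p(a), y_b = p(M⁻¹ b)
-- is a feasible dual of objective 0, so optimality of α gives Σ_a (α_a + α_{M a}) ≤ 0, while
-- every term is at least wt_M(a, M a) = 0: hence α_a + α_{M a} = 0 for all a.  With this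
-- tightness S matches every node of G*.  Edges at the nodes d_i(a) cannot block by the shape
-- of the rankings, and a blocking edge (a_i, b̃) violates α_a + α_b ≥ wt_M(a, b): if
-- i = α_b / 2 = -α_a / 2, then a and b prefer each other to their M-partners and
-- wt_M(a, b) = 2 > 0; otherwise the order of the subscripts forces α_a + α_b ≤ -2, hence
-- wt_M(a, b) = -2, contradicting the preference of a or of b that makes the edge blocking.

module Submission where

open import Defs
open import Data.Nat as ℕ using (ℕ; zero; suc; z≤n; s≤s; _<_; _<?_)
import Data.Nat.Properties as ℕP
open import Data.Fin using (Fin; zero; suc; toℕ; fromℕ<; _≟_)
import Data.Fin.Properties as Fin
open import Data.Fin.Permutation as Perm using (Permutation′; _⟨$⟩ʳ_; _⟨$⟩ˡ_; _∘ₚ_; permutation)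
import Data.Fin.Permutation.Components as PC
open import Data.Integer as ℤ using (ℤ; +_; -[1+_]; _+_; _-_; -_; _≤_)
import Data.Integer.Properties as ℤP
open import Data.Integer.Tactic.RingSolver using (solve-∀)
open import Data.Rational as ℚ using (ℚ; mkℚ; _/_; 0ℚ)
import Data.Rational.Properties as ℚP
import Data.Rational.Unnormalised as ℚᵘ
import Data.Rational.Unnormalised.Properties as ℚᵘP
open import Data.Nat.Coprimality using (1-coprimeTo) renaming (sym to coprime-sym)
open import Data.Bool using (Bool; true; false; T; if_then_else_; _∧_)
import Data.Bool.Properties as Bool
open import Data.List using (List; []; _∷_; _++_; length; lookup; filter; allFin; tabulate)
open import Data.List.Relation.Unary.All as All using (All; []; _∷_)
import Data.List.Relation.Unary.All.Properties as All
open import Data.List.Relation.Unary.Unique.Propositional using (Unique; []; _∷_)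
open import Data.List.Membership.Propositional.Properties using (∈-lookup; ∈-∃++)
open import Data.Unit using (⊤; tt)
open import Data.Empty using (⊥)
open import Data.Product using (Σ; ∃; _×_; _,_; proj₁; proj₂)
open import Data.Sum using (inj₁; inj₂)
open import Function using (_∘_; id; Equivalence)
open import Level using (0ℓ)
open import Effect.Monad using (RawMonad)
open import Relation.Unary using (Pred; Decidable)
open import Relation.Nullary using (¬_; yes; no; does; contradiction)
open import Relation.Nullary.Negation using (DoubleNegation; ¬¬-Monad; ¬¬-map)
open import Relation.Nullary.Decidable
  using (⌊_⌋; isYes≗does; dec-true; dec-false; fromWitness; toWitness; ¬¬-excluded-middle; decidable-stable)
open import Relation.Binary.Definitions using (tri<; tri≈; tri>)
open import Relation.Binary.PropositionalEquality
open import Algebra.Properties.CommutativeMonoid.Sum ℤP.+-0-commutativeMonoid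
  using (sum; sum-cong-≗; sum-replicate-zero; ∑-distrib-+; ∑-permute)

sum-neg : ∀ {k} (f : Fin k → ℤ) → sum (λ i → - f i) ≡ - sum f
sum-neg {zero}  f = refl
sum-neg {suc k} f = begin
  - f zero + sum (λ i → - f (suc i)) ≡⟨ cong (λ t → - f zero + t) (sum-neg (f ∘ suc)) ⟩
  - f zero + - sum (f ∘ suc)         ≡⟨ ℤP.neg-distrib-+ (f zero) (sum (f ∘ suc)) ⟨
  - sum f                            ∎
  where open ≡-Reasoning

sum-sub : ∀ {k} (f g : Fin k → ℤ) → sum (λ i → f i - g i) ≡ sum f - sum g
sum-sub f g = trans (∑-distrib-+ f (λ i → - g i)) (cong (λ t → sum f + t) (sum-neg g))

sum-zero : ∀ {k} {f : Fin k → ℤ} → (∀ i → f i ≡ + 0) → sum f ≡ + 0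
sum-zero {k} f≡0 = trans (sum-cong-≗ f≡0) (sum-replicate-zero k)

sum-nonneg : ∀ {k} {f : Fin k → ℤ} → (∀ i → + 0 ≤ f i) → + 0 ≤ sum f
sum-nonneg {zero}  f≥0 = ℤP.≤-refl
sum-nonneg {suc k} f≥0 = ℤP.+-mono-≤ (f≥0 zero) (sum-nonneg (f≥0 ∘ suc))

nonneg-sum≤0⇒≡0 : ∀ {k} {f : Fin k → ℤ} → (∀ i → + 0 ≤ f i) → sum f ≤ + 0 →
                  ∀ i → f i ≡ + 0
nonneg-sum≤0⇒≡0 {f = f} f≥0 Σf≤0 zero = ℤP.≤-antisym f₀≤0 (f≥0 zero)
  where
  open ℤP.≤-Reasoning
  f₀≤0 : f zero ≤ + 0
  f₀≤0 = begin
    f zero                 ≡⟨ ℤP.+-identityʳ (f zero) ⟨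
    f zero + + 0           ≤⟨ ℤP.+-monoʳ-≤ (f zero) (sum-nonneg (f≥0 ∘ suc)) ⟩
    f zero + sum (f ∘ suc) ≤⟨ Σf≤0 ⟩
    + 0                    ∎
nonneg-sum≤0⇒≡0 {f = f} f≥0 Σf≤0 (suc i) = nonneg-sum≤0⇒≡0 (f≥0 ∘ suc) Σtail≤0 i
  where
  open ℤP.≤-Reasoning
  Σtail≤0 : sum (f ∘ suc) ≤ + 0
  Σtail≤0 = begin
    sum (f ∘ suc)          ≡⟨ ℤP.+-identityˡ (sum (f ∘ suc)) ⟨
    + 0 + sum (f ∘ suc)    ≤⟨ ℤP.+-monoˡ-≤ (sum (f ∘ suc)) (f≥0 zero) ⟩
    f zero + sum (f ∘ suc) ≤⟨ Σf≤0 ⟩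
    + 0                    ∎

sum-supported-at : ∀ {k} {f : Fin k → ℤ} x → (∀ z → ¬ z ≡ x → f z ≡ + 0) → sum f ≡ f x
sum-supported-at {f = f} zero    f≡0 =
  trans (cong (λ t → f zero + t) (sum-zero (λ z → f≡0 (suc z) λ ()))) (ℤP.+-identityʳ (f zero))
sum-supported-at {f = f} (suc x) f≡0 =
  trans (cong (λ t → t + sum (f ∘ suc)) (f≡0 zero λ ()))
        (trans (ℤP.+-identityˡ _) (sum-supported-at x (λ z z≢x → f≡0 (suc z) (z≢x ∘ Fin.suc-injective))))

sum-supported-at₂ : ∀ {k} {f : Fin k → ℤ} {x y} → ¬ x ≡ y →
                    (∀ z → ¬ z ≡ x → ¬ z ≡ y → f z ≡ + 0) → sum f ≡ f x + f y
sum-supported-at₂ {x = zero}  {zero}  x≢y f≡0 = contradiction refl x≢y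
sum-supported-at₂ {f = f} {zero} {suc y} x≢y f≡0 =
  cong (λ t → f zero + t) (sum-supported-at y (λ z z≢y → f≡0 (suc z) (λ ()) (z≢y ∘ Fin.suc-injective)))
sum-supported-at₂ {f = f} {suc x} {zero} x≢y f≡0 =
  trans (cong (λ t → f zero + t) (sum-supported-at x (λ z z≢x → f≡0 (suc z) (z≢x ∘ Fin.suc-injective) (λ ()))))
        (ℤP.+-comm (f zero) (f (suc x)))
sum-supported-at₂ {f = f} {suc x} {suc y} x≢y f≡0 =
  trans (cong (λ t → t + sum (f ∘ suc)) (f≡0 zero (λ ()) (λ ())))
        (trans (ℤP.+-identityˡ _)
               (sum-supported-at₂ (x≢y ∘ cong suc)
                  (λ z z≢x z≢y → f≡0 (suc z) (z≢x ∘ Fin.suc-injective) (z≢y ∘ Fin.suc-injective))))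

sum-differs-at₂ : ∀ {k} {f g : Fin k → ℤ} {x y} → ¬ x ≡ y →
                  (∀ z → ¬ z ≡ x → ¬ z ≡ y → f z ≡ g z) →
                  sum f ≡ sum g + (f x - g x) + (f y - g y)
sum-differs-at₂ {f = f} {g} {x} {y} x≢y f≡g = begin
  sum f                               ≡⟨ sum-cong-≗ (λ z → split (f z) (g z)) ⟩
  sum (λ z → g z + (f z - g z))       ≡⟨ ∑-distrib-+ g (λ z → f z - g z) ⟩
  sum g + sum (λ z → f z - g z)       ≡⟨ cong (λ t → sum g + t) (sum-supported-at₂ x≢y
                                           (λ z z≢x z≢y → trans (cong (λ t → t - g z) (f≡g z z≢x z≢y))
                                                                (ℤP.+-inverseʳ (g z)))) ⟩
  sum g + ((f x - g x) + (f y - g y)) ≡⟨ ℤP.+-assoc (sum g) _ _ ⟨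
  sum g + (f x - g x) + (f y - g y)   ∎
  where
  open ≡-Reasoning
  split : ∀ a b → a ≡ b + (a - b)
  split = solve-∀

toℚ : ℤ → ℚ
toℚ x = x / 1

toℚ≡mkℚ : ∀ x → toℚ x ≡ mkℚ x 0 (coprime-sym (1-coprimeTo ℤ.∣ x ∣))
toℚ≡mkℚ x = ℚP.↥p/↧p≡p (mkℚ x 0 (coprime-sym (1-coprimeTo ℤ.∣ x ∣)))

toℚᵘ∘toℚ : ∀ x → ℚ.toℚᵘ (toℚ x) ≡ ℚᵘ.mkℚᵘ x 0
toℚᵘ∘toℚ x rewrite toℚ≡mkℚ x = refl

toℚ-+ : ∀ x y → toℚ (x + y) ≡ toℚ x ℚ.+ toℚ y
toℚ-+ x y = ℚP.toℚᵘ-injective (begin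
  ℚ.toℚᵘ (toℚ (x + y))               ≡⟨ toℚᵘ∘toℚ (x + y) ⟩
  ℚᵘ.mkℚᵘ (x + y) 0                  ≈⟨ ℚᵘ.*≡* (lemma x y) ⟩
  ℚᵘ.mkℚᵘ x 0 ℚᵘ.+ ℚᵘ.mkℚᵘ y 0       ≡⟨ cong₂ ℚᵘ._+_ (toℚᵘ∘toℚ x) (toℚᵘ∘toℚ y) ⟨
  ℚ.toℚᵘ (toℚ x) ℚᵘ.+ ℚ.toℚᵘ (toℚ y) ≈⟨ ℚP.toℚᵘ-homo-+ (toℚ x) (toℚ y) ⟨
  ℚ.toℚᵘ (toℚ x ℚ.+ toℚ y)           ∎)
  where
  open ℚᵘP.≃-Reasoning
  lemma : ∀ x y → (x + y) ℤ.* (+ 1 ℤ.* + 1) ≡ (x ℤ.* + 1 + y ℤ.* + 1) ℤ.* + 1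
  lemma = solve-∀

toℚ-neg : ∀ x → toℚ (- x) ≡ ℚ.- toℚ x
toℚ-neg x rewrite toℚ≡mkℚ (- x) | toℚ≡mkℚ x with x
... | + zero   = refl
... | + suc m  = refl
... | -[1+ m ] = refl

toℚ-mono-≤ : ∀ {x y} → x ≤ y → toℚ x ℚ.≤ toℚ y
toℚ-mono-≤ {x} {y} x≤y rewrite toℚ≡mkℚ x | toℚ≡mkℚ y =
  ℚ.*≤* (subst₂ _≤_ (sym (ℤP.*-identityʳ x)) (sym (ℤP.*-identityʳ y)) x≤y)

toℚ-cancel-≤ : ∀ {x y} → toℚ x ℚ.≤ toℚ y → x ≤ y
toℚ-cancel-≤ {x} {y} p with ℚP.drop-*≤* p
... | q rewrite toℚ≡mkℚ x | toℚ≡mkℚ y = subst₂ _≤_ (ℤP.*-identityʳ x) (ℤP.*-identityʳ y) q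

-- Potentials of digraphs without positive cycles

lookup-injective : ∀ {n} {xs : List (Fin n)} → Unique xs → ∀ i j → lookup xs i ≡ lookup xs j → i ≡ j
lookup-injective (_ ∷ _)           zero    zero    _ = refl
lookup-injective (x∉xs ∷ _)        zero    (suc j) e = contradiction e (All.lookup x∉xs (∈-lookup j))
lookup-injective (x∉xs ∷ _)        (suc i) zero    e = contradiction (sym e) (All.lookup x∉xs (∈-lookup i))
lookup-injective (_ ∷ unique-xs)   (suc i) (suc j) e = cong suc (lookup-injective unique-xs i j e)

Unique⇒length≤ : ∀ {n} {xs : List (Fin n)} → Unique xs → length xs ℕ.≤ n
Unique⇒length≤ unique = Fin.injective⇒≤ (lookup-injective unique _ _)

Unique-split : ∀ {A : Set} {y : A} xs {zs} → Unique (xs ++ y ∷ zs) → Unique (xs ++ y ∷ []) × Unique (y ∷ zs)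
Unique-split []       unique             = ([] ∷ []) , unique
Unique-split (x ∷ xs) (x∉rest ∷ unique) with All.++⁻ xs x∉rest | Unique-split xs unique
... | x∉xs , x≢y ∷ _ | unique-xsy , unique-yzs = (All.++⁺ x∉xs (x≢y ∷ []) ∷ unique-xsy) , unique-yzs

open RawMonad (¬¬-Monad {0ℓ}) using (pure; _>>=_; rawApplicative)

i<j⇒i+suc[k]≤j+k : ∀ {i j} k → i ℤ.< j → i + + suc k ≤ j + + k
i<j⇒i+suc[k]≤j+k {i} {j} k i<j = begin
  i + + suc k       ≡⟨ cong (λ t → i + t) (ℤP.pos-+ 1 k) ⟩
  i + (+ 1 + + k)   ≡⟨ shift i (+ k) ⟩
  ℤ.suc i + + k     ≤⟨ ℤP.+-monoˡ-≤ (+ k) (ℤP.i<j⇒suc[i]≤j i<j) ⟩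
  j + + k           ∎
  where
  open ℤP.≤-Reasoning
  shift : ∀ x y → x + (+ 1 + y) ≡ + 1 + x + y
  shift = solve-∀

¬¬-argmax : ∀ {A : Set} (f : A → ℤ) (a₀ : A) (k : ℕ) → (∀ a → f a ≤ f a₀ + + k) →
            DoubleNegation (∃ λ a → ∀ a′ → f a′ ≤ f a)
¬¬-argmax f a₀ zero    bounded = pure (a₀ , λ a → subst (f a ≤_) (ℤP.+-identityʳ (f a₀)) (bounded a))
¬¬-argmax f a₀ (suc k) bounded = ¬¬-excluded-middle {A = ∃ λ a → f a₀ ℤ.< f a} >>= λ where
  (yes (a₁ , f₀<f₁)) → ¬¬-argmax f a₁ k (λ a → ℤP.≤-trans (bounded a) (i<j⇒i+suc[k]≤j+k k f₀<f₁))
  (no  ¬bigger)      → pure (a₀ , λ a → ℤP.≮⇒≥ (λ f₀<fa → ¬bigger (a , f₀<fa)))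

transpose-matchˡ : ∀ {n} (x y : Fin n) → PC.transpose x y x ≡ y
transpose-matchˡ x y rewrite dec-true (x ≟ x) refl = refl

transpose-matchʳ : ∀ {n} (x y : Fin n) → PC.transpose x y y ≡ x
transpose-matchʳ x y with y ≟ x
... | yes y≡x = y≡x
... | no  y≢x rewrite dec-true (y ≟ y) refl = refl

transpose-other : ∀ {n} {x y z : Fin n} → ¬ z ≡ x → ¬ z ≡ y → PC.transpose x y z ≡ z
transpose-other {x = x} {y} {z} z≢x z≢y rewrite dec-false (z ≟ x) z≢x | dec-false (z ≟ y) z≢y = refl

module WeightedDigraph {n : ℕ} (Edge : Fin n → Fin n → Set) (w : Fin n → Fin n → ℤ) where

  open import Data.List.Membership.DecPropositional (_≟_ {n}) using (_∈?_)

  -- y ∷ ys lists the vertices of a path … → y → x backwards from its target x.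
  PathInto : Fin n → List (Fin n) → Set
  PathInto x []       = ⊤
  PathInto x (y ∷ ys) = Edge y x × PathInto y ys

  pathWeight : Fin n → List (Fin n) → ℤ
  pathWeight x []       = + 0
  pathWeight x (y ∷ ys) = w y x + pathWeight y ys

  source : Fin n → List (Fin n) → Fin n
  source x []       = x
  source x (y ∷ ys) = source y ys

  cycleWeight : Fin n → List (Fin n) → ℤ
  cycleWeight x ys = pathWeight x ys + w x (source x ys)

  NoPositiveCycle : Set
  NoPositiveCycle = ∀ x ys → PathInto x ys → Unique (x ∷ ys) → Edge x (source x ys) →
                    cycleWeight x ys ≤ + 0

  IsPotential : (Fin n → ℤ) → Set
  IsPotential p = ∀ x y → Edge x y → p x + w x y ≤ p y

  -- rotation x ys maps each vertex of the cycle x ∷ ys to its successor along the arcs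
  -- (x to source x ys) and fixes all other vertices.
  rotation : Fin n → List (Fin n) → Permutation′ n
  rotation x []       = Perm.id
  rotation x (y ∷ ys) = Perm.transpose x y ∘ₚ rotation y ys

  rotation-target : ∀ x ys → rotation x ys ⟨$⟩ʳ x ≡ source x ys
  rotation-target x []       = refl
  rotation-target x (y ∷ ys) rewrite transpose-matchˡ x y = rotation-target y ys

  rotation-fixes : ∀ {z} x ys → ¬ z ≡ x → All (z ≢_) ys → rotation x ys ⟨$⟩ʳ z ≡ z
  rotation-fixes x []       _   _              = refl
  rotation-fixes x (y ∷ ys) z≢x (z≢y ∷ z∉ys) rewrite transpose-other z≢x z≢y = rotation-fixes y ys z≢y z∉ys

  module _ (Edge-refl : ∀ z → Edge z z) where

    rotation-along-path : ∀ x ys → PathInto x ys → Unique (x ∷ ys) →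
                          ∀ z → ¬ z ≡ x → Edge z (rotation x ys ⟨$⟩ʳ z)
    rotation-along-path x []       _          _                          z _   = Edge-refl z
    rotation-along-path x (y ∷ ys) (y→x , py) ((x≢y ∷ x∉ys) ∷ unique-ys) z z≢x with z ≟ y
    ... | yes refl rewrite transpose-matchʳ x z | rotation-fixes z ys x≢y x∉ys = y→x
    ... | no  z≢y  rewrite transpose-other z≢x z≢y = rotation-along-path y ys py unique-ys z z≢y

    rotation-edges : ∀ x ys → PathInto x ys → Unique (x ∷ ys) → Edge x (source x ys) →
                     ∀ z → Edge z (rotation x ys ⟨$⟩ʳ z)
    rotation-edges x ys px unique closing z with z ≟ x
    ... | yes refl rewrite rotation-target z ys = closing
    ... | no  z≢x  = rotation-along-path x ys px unique z z≢x

  module _ (w-refl : ∀ z → w z z ≡ + 0) where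

    sum-rotation : ∀ x ys → Unique (x ∷ ys) →
                   sum (λ z → w z (rotation x ys ⟨$⟩ʳ z)) ≡ cycleWeight x ys
    sum-rotation x [] _ = trans (sum-zero w-refl) (sym (trans (ℤP.+-identityˡ (w x x)) (w-refl x)))
    sum-rotation x (y ∷ ys) ((x≢y ∷ x∉ys) ∷ unique-ys) = begin
      sum F                                       ≡⟨ sum-differs-at₂ x≢y F≡G-elsewhere ⟩
      sum G + (F x - G x) + (F y - G y)           ≡⟨ cong₂ _+_ (cong₂ _+_ (sum-rotation y ys unique-ys) Fx-Gx) Fy-Gy ⟩
      P + w y L + (w x L - + 0) + (w y x - w y L) ≡⟨ rearrange P (w y L) (w x L) (w y x) ⟩
      w y x + P + w x L                           ∎
      where
      open ≡-Reasoning
      ρ = rotation y ys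
      L = source y ys
      P = pathWeight y ys
      F G : Fin n → ℤ
      F z = w z (ρ ⟨$⟩ʳ PC.transpose x y z)
      G z = w z (ρ ⟨$⟩ʳ z)
      F≡G-elsewhere : ∀ z → ¬ z ≡ x → ¬ z ≡ y → F z ≡ G z
      F≡G-elsewhere z z≢x z≢y = cong (w z ∘ (ρ ⟨$⟩ʳ_)) (transpose-other z≢x z≢y)
      x-fixed : ρ ⟨$⟩ʳ x ≡ x
      x-fixed = rotation-fixes y ys x≢y x∉ys
      Fx-Gx : F x - G x ≡ w x L - + 0
      Fx-Gx rewrite transpose-matchˡ x y =
        cong₂ _-_ (cong (w x) (rotation-target y ys)) (trans (cong (w x) x-fixed) (w-refl x))
      Fy-Gy : F y - G y ≡ w y x - w y L
      Fy-Gy rewrite transpose-matchʳ x y = cong₂ _-_ (cong (w y) x-fixed) (cong (w y) (rotation-target y ys))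
      rearrange : ∀ a b c d → a + b + (c - + 0) + (d - b) ≡ d + a + c
      rearrange = solve-∀

  nonpositive-exchanges⇒NoPositiveCycle :
    (∀ z → Edge z z) → (∀ z → w z z ≡ + 0) →
    (∀ (π : Permutation′ n) → (∀ z → Edge z (π ⟨$⟩ʳ z)) → sum (λ z → w z (π ⟨$⟩ʳ z)) ≤ + 0) →
    NoPositiveCycle
  nonpositive-exchanges⇒NoPositiveCycle Edge-refl w-refl nonpositive x ys px unique closing =
    subst (_≤ + 0) (sum-rotation w-refl x ys unique)
          (nonpositive (rotation x ys) (rotation-edges Edge-refl x ys px unique closing))

  PathInto-split : ∀ x l₁ {y l₂} → PathInto x (l₁ ++ y ∷ l₂) →
                   PathInto x (l₁ ++ y ∷ []) × PathInto y l₂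
  PathInto-split x []       (y→x , py) = (y→x , tt) , py
  PathInto-split x (z ∷ l₁) (z→x , pz) = let (p₁ , p₂) = PathInto-split z l₁ pz in (z→x , p₁) , p₂

  pathWeight-split : ∀ x l₁ y l₂ →
                     pathWeight x (l₁ ++ y ∷ l₂) ≡ pathWeight x (l₁ ++ y ∷ []) + pathWeight y l₂
  pathWeight-split x []       y l₂ = cong (_+ pathWeight y l₂) (sym (ℤP.+-identityʳ (w y x)))
  pathWeight-split x (z ∷ l₁) y l₂ rewrite pathWeight-split z l₁ y l₂ = sym (ℤP.+-assoc (w z x) _ _)

  source-snoc : ∀ x l₁ y → source x (l₁ ++ y ∷ []) ≡ y
  source-snoc x []       y = refl
  source-snoc x (z ∷ l₁) y = source-snoc z l₁ y

  record SimplePathInto (x : Fin n) : Set where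
    constructor simplePath
    field
      vertices : List (Fin n)
      isPath   : PathInto x vertices
      unique   : Unique (x ∷ vertices)

  weightOf : ∀ {x} → SimplePathInto x → ℤ
  weightOf {x} π = pathWeight x (SimplePathInto.vertices π)

  Heaviest : Fin n → Set
  Heaviest x = Σ (SimplePathInto x) λ π → ∀ (π′ : SimplePathInto x) → weightOf π′ ≤ weightOf π

  module _ (noPositiveCycle : NoPositiveCycle) where

    closing-cycle : ∀ x l₁ y l₂ → PathInto x (l₁ ++ y ∷ l₂) → Unique (x ∷ l₁ ++ y ∷ l₂) →
                    Edge x y → pathWeight x (l₁ ++ y ∷ l₂) + w x y ≤ pathWeight y l₂
    closing-cycle x l₁ y l₂ px unique x→y = begin
      pathWeight x (l₁ ++ y ∷ l₂) + w x y   ≡⟨ cong (_+ w x y) (pathWeight-split x l₁ y l₂) ⟩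
      C + pathWeight y l₂ + w x y           ≡⟨ swap C (pathWeight y l₂) (w x y) ⟩
      C + w x y + pathWeight y l₂           ≡⟨ cong (λ z → C + w x z + pathWeight y l₂) (source-snoc x l₁ y) ⟨
      cycleWeight x cycle + pathWeight y l₂ ≤⟨ ℤP.+-monoˡ-≤ (pathWeight y l₂) cycle≤0 ⟩
      + 0 + pathWeight y l₂                 ≡⟨ ℤP.+-identityˡ _ ⟩
      pathWeight y l₂                       ∎
      where
      open ℤP.≤-Reasoning
      cycle = l₁ ++ y ∷ []
      C = pathWeight x cycle
      swap : ∀ a b c → a + b + c ≡ a + c + b
      swap = solve-∀
      cycle≤0 : cycleWeight x cycle ≤ + 0
      cycle≤0 = noPositiveCycle x cycle (proj₁ (PathInto-split x l₁ px))
                  (proj₁ (Unique-split (x ∷ l₁) unique))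
                  (subst (Edge x) (sym (source-snoc x l₁ y)) x→y)

    heavier-than-extensions : ∀ {x y b} (π : SimplePathInto x) → Edge x y → ¬ y ≡ x →
                              (∀ (π′ : SimplePathInto y) → weightOf π′ ≤ b) → weightOf π + w x y ≤ b
    heavier-than-extensions {x} {y} (simplePath ys px unique) x→y y≢x bounded with y ∈? ys
    ... | no y∉ys = subst (_≤ _) (ℤP.+-comm (w x y) (pathWeight x ys))
                      (bounded (simplePath (x ∷ ys) (x→y , px) ((y≢x ∷ All.¬Any⇒All¬ ys y∉ys) ∷ unique)))
    ... | yes y∈ys with ∈-∃++ y∈ys
    ...   | l₁ , l₂ , refl = ℤP.≤-trans (closing-cycle x l₁ y l₂ px unique x→y)
                               (bounded (simplePath l₂ (proj₂ (PathInto-split x l₁ px))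
                                                        (proj₂ (Unique-split (x ∷ l₁) unique))))

    w-loop≤0 : ∀ x → Edge x x → w x x ≤ + 0
    w-loop≤0 x x→x = subst (_≤ + 0) (ℤP.+-identityˡ (w x x)) (noPositiveCycle x [] tt ([] ∷ []) x→x)

    heaviest⇒IsPotential : (h : ∀ x → Heaviest x) → IsPotential (λ x → weightOf (proj₁ (h x)))
    heaviest⇒IsPotential h x y x→y with y ≟ x
    ... | yes refl = let p = weightOf (proj₁ (h x)) in
                     subst (p + w x x ≤_) (ℤP.+-identityʳ p) (ℤP.+-monoʳ-≤ p (w-loop≤0 x x→y))
    ... | no  y≢x  = heavier-than-extensions (proj₁ (h x)) x→y y≢x (proj₂ (h y))

    module _ (c : ℕ) (w≤c : ∀ x y → w x y ≤ + c) where

      pathWeight≤ : ∀ x ys → pathWeight x ys ≤ + (c ℕ.* length ys)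
      pathWeight≤ x []       = ℤ.+≤+ ℕ.z≤n
      pathWeight≤ x (y ∷ ys) = subst (pathWeight x (y ∷ ys) ≤_)
        (trans (sym (ℤP.pos-+ c (c ℕ.* length ys))) (cong +_ (sym (ℕP.*-suc c (length ys)))))
        (ℤP.+-mono-≤ (w≤c y x) (pathWeight≤ y ys))

      weightOf≤ : ∀ {x} (π : SimplePathInto x) → weightOf π ≤ + 0 + + (c ℕ.* n)
      weightOf≤ {x} (simplePath ys _ unique) = begin
        pathWeight x ys         ≤⟨ pathWeight≤ x ys ⟩
        + (c ℕ.* length ys)     ≤⟨ ℤ.+≤+ (ℕP.*-monoʳ-≤ c (ℕP.<⇒≤ (Unique⇒length≤ unique))) ⟩
        + (c ℕ.* n)             ≡⟨ ℤP.+-identityˡ _ ⟨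
        + 0 + + (c ℕ.* n)       ∎
        where open ℤP.≤-Reasoning

      -- E is not decidable, so heaviest simple paths are only available under ¬¬.
      ¬¬-potential : DoubleNegation (∃ IsPotential)
      ¬¬-potential = do
        heaviest ← Fin.sequence rawApplicative
                     (λ x → ¬¬-argmax weightOf (simplePath [] tt ([] ∷ [])) (c ℕ.* n) weightOf≤)
        pure (_ , heaviest⇒IsPotential heaviest)

𝟙 : Bool → ℤ
𝟙 true  = + 1
𝟙 false = + 0

count-filter : ∀ {k} {P : Pred (Fin k) 0ℓ} (P? : Decidable P) →
               + length (filter P? (allFin k)) ≡ sum (λ i → 𝟙 ⌊ P? i ⌋)
count-filter = count-tabulate id
  where
  count-tabulate : ∀ {k} {A : Set} (f : Fin k → A) {P : Pred A 0ℓ} (P? : Decidable P) →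
                   + length (filter P? (tabulate f)) ≡ sum (λ i → 𝟙 ⌊ P? (f i) ⌋)
  count-tabulate {zero}  f P? = refl
  count-tabulate {suc k} f P? rewrite isYes≗does (P? (f zero)) with does (P? (f zero))
  ... | true  = cong (λ t → + 1 + t) (count-tabulate (f ∘ suc) P?)
  ... | false = trans (count-tabulate (f ∘ suc) P?) (sym (ℤP.+-identityˡ _))

_≺_ : ℕ → ℕ → Bool
p ≺ q = ⌊ p <? q ⌋

≺⇒< : ∀ {p q} → T (p ≺ q) → p < q
≺⇒< = toWitness

<⇒≺ : ∀ {p q} → p < q → T (p ≺ q)
<⇒≺ = fromWitness

≺-true : ∀ {p q} → p < q → p ≺ q ≡ true
≺-true = Equivalence.to Bool.T-≡ ∘ <⇒≺

≺-false : ∀ {p q} → ¬ p < q → p ≺ q ≡ false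
≺-false {p} {q} p≮q = trans (isYes≗does (p <? q)) (dec-false (p <? q) p≮q)

data Comparison (p q : ℕ) : Bool → Bool → Set where
  less    : p < q → Comparison p q true false
  equal   : p ≡ q → Comparison p q false false
  greater : q < p → Comparison p q false true

compare : ∀ p q → Comparison p q (p ≺ q) (q ≺ p)
compare p q with ℕP.<-cmp p q
... | tri< p<q _ q≮p rewrite ≺-true p<q | ≺-false q≮p = less p<q
... | tri≈ p≮q p≡q q≮p rewrite ≺-false p≮q | ≺-false q≮p = equal p≡q
... | tri> p≮q _ q<p rewrite ≺-false p≮q | ≺-true q<p = greater q<p

weight : Bool → Bool → ℤ
weight blocking dominated = if blocking then + 2 else if dominated then -[1+ 1 ] else + 0

toℚ-weight : ∀ b d → (if b then + 2 / 1 else if d then ℚ.- (+ 2 / 1) else 0ℚ) ≡ toℚ (weight b d)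
toℚ-weight true  _     = refl
toℚ-weight false true  = refl
toℚ-weight false false = refl

weight≤2 : ∀ b d → weight b d ≤ + 2
weight≤2 true  _     = ℤP.≤-refl
weight≤2 false true  = ℤ.-≤+
weight≤2 false false = ℤ.+≤+ ℕ.z≤n

-2≤weight : ∀ b d → -[1+ 1 ] ≤ weight b d
-2≤weight true  _     = ℤ.-≤+
-2≤weight false true  = ℤP.≤-refl
-2≤weight false false = ℤ.-≤+

weight≤-2⇒dominated : ∀ b d → weight b d ≤ -[1+ 1 ] → T d
weight≤-2⇒dominated false true _ = _
weight≤-2⇒dominated true  _     ()
weight≤-2⇒dominated false false ()

votes : ∀ {p q r t b₁ b₂ b₃ b₄} → Comparison p q b₁ b₂ → Comparison r t b₃ b₄ →
        (p ≡ q → r ≡ t) → (r ≡ t → p ≡ q) →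
        (𝟙 b₁ - 𝟙 b₂) + (𝟙 b₃ - 𝟙 b₄) ≡ weight (b₁ ∧ b₃) (b₂ ∧ b₄)
votes (less _)      (less _)      _ _ = refl
votes (less _)      (greater _)   _ _ = refl
votes (greater _)   (less _)      _ _ = refl
votes (greater _)   (greater _)   _ _ = refl
votes (equal _)     (equal _)     _ _ = refl
votes (less p<q)    (equal r≡t)   _ ⇐ = contradiction (⇐ r≡t) (ℕP.<⇒≢ p<q)
votes (greater q<p) (equal r≡t)   _ ⇐ = contradiction (sym (⇐ r≡t)) (ℕP.<⇒≢ q<p)
votes (equal p≡q)   (less r<t)    ⇒ _ = contradiction (⇒ p≡q) (ℕP.<⇒≢ r<t)
votes (equal p≡q)   (greater t<r) ⇒ _ = contradiction (sym (⇒ p≡q)) (ℕP.<⇒≢ t<r)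

≺-irrefl : ∀ p → p ≺ p ≡ false
≺-irrefl p = ≺-false (ℕP.<-irrefl refl)

weight-tie : ∀ p r → weight (p ≺ p ∧ r ≺ r) (p ≺ p ∧ r ≺ r) ≡ + 0
weight-tie p r rewrite ≺-irrefl p = refl

weight-blocking : ∀ b d → T b → weight b d ≡ + 2
weight-blocking true _ _ = refl

-- Popularity and the dual linear program

module _ {n : ℕ} (G : Graph n) where
  open Graph G

  blocks dominated : PerfectMatching G → Fin n → Fin n → Bool
  blocks    M a b = rankA a b ≺ rankA a (mA M a) ∧ rankB b a ≺ rankB b (mB M b)
  dominated M a b = rankA a (mA M a) ≺ rankA a b ∧ rankB b (mB M b) ≺ rankB b a

  wtℤ : PerfectMatching G → Fin n → Fin n → ℤ
  wtℤ M a b = weight (blocks M a b) (dominated M a b)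

  wt≡toℚ-wtℤ : ∀ M a b → wt G M a b ≡ toℚ (wtℤ M a b)
  wt≡toℚ-wtℤ M a b = toℚ-weight (blocks M a b) (dominated M a b)

  wtℤ≤2 : ∀ M a b → wtℤ M a b ≤ + 2
  wtℤ≤2 M a b = weight≤2 (blocks M a b) (dominated M a b)

  -2≤wtℤ : ∀ M a b → -[1+ 1 ] ≤ wtℤ M a b
  -2≤wtℤ M a b = -2≤weight (blocks M a b) (dominated M a b)

  wtℤ≤-2⇒dominated : ∀ M a b → wtℤ M a b ≤ -[1+ 1 ] →
                     rankA a (mA M a) ℕ.< rankA a b × rankB b (mB M b) ℕ.< rankB b a
  wtℤ≤-2⇒dominated M a b wt≤-2 =
    let (≺ᴬ , ≺ᴮ) = Equivalence.to Bool.T-∧ (weight≤-2⇒dominated (blocks M a b) (dominated M a b) wt≤-2)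
    in ≺⇒< ≺ᴬ , ≺⇒< ≺ᴮ

  wtℤ-blocking : ∀ M a b → rankA a b ℕ.< rankA a (mA M a) → rankB b a ℕ.< rankB b (mB M b) →
                 wtℤ M a b ≡ + 2
  wtℤ-blocking M a b <ᴬ <ᴮ =
    weight-blocking (blocks M a b) (dominated M a b) (Equivalence.from Bool.T-∧ (<⇒≺ <ᴬ , <⇒≺ <ᴮ))

  prefersA prefersB : PerfectMatching G → PerfectMatching G → Fin n → Bool
  prefersA N M a = rankA a (mA N a) ≺ rankA a (mA M a)
  prefersB N M b = rankB b (mB N b) ≺ rankB b (mB M b)

  φ≡sum : ∀ N M → + φ G N M ≡ sum (𝟙 ∘ prefersA N M) + sum (𝟙 ∘ prefersB N M)
  φ≡sum N M = cong₂ _+_ (count-filter (λ a → rankA a (mA N a) ℕ.<? rankA a (mA M a)))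
                        (count-filter (λ b → rankB b (mB N b) ℕ.<? rankB b (mB M b)))

  voteA voteB : PerfectMatching G → PerfectMatching G → Fin n → ℤ
  voteA N M a = 𝟙 (prefersA N M a) - 𝟙 (prefersA M N a)
  voteB N M b = 𝟙 (prefersB N M b) - 𝟙 (prefersB M N b)

  Δ≡sum-votes : ∀ N M → + φ G N M - + φ G M N ≡ sum (voteA N M) + sum (voteB N M)
  Δ≡sum-votes N M = begin
    + φ G N M - + φ G M N                 ≡⟨ cong₂ _-_ (φ≡sum N M) (φ≡sum M N) ⟩
    (ΣA N M + ΣB N M) - (ΣA M N + ΣB M N) ≡⟨ rearrange (ΣA N M) (ΣB N M) (ΣA M N) (ΣB M N) ⟩
    (ΣA N M - ΣA M N) + (ΣB N M - ΣB M N) ≡⟨ cong₂ _+_ (sum-sub (𝟙 ∘ prefersA N M) (𝟙 ∘ prefersA M N))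
                                                       (sum-sub (𝟙 ∘ prefersB N M) (𝟙 ∘ prefersB M N)) ⟨
    sum (voteA N M) + sum (voteB N M)     ∎
    where
    open ≡-Reasoning
    ΣA ΣB : PerfectMatching G → PerfectMatching G → ℤ
    ΣA N M = sum (𝟙 ∘ prefersA N M)
    ΣB N M = sum (𝟙 ∘ prefersB N M)
    rearrange : ∀ a b c d → (a + b) - (c + d) ≡ (a - c) + (b - d)
    rearrange = solve-∀

  asPermutation : PerfectMatching G → Permutation′ n
  asPermutation M = permutation (mA M) (mB M) (mAB M) (mBA M)

  module ExchangeGraph (M : PerfectMatching G) where

    -- Vertex a′ stands for the M-edge (a′, M a′); an arc a → a′ lets a take over M a′.
    Exchange : Fin n → Fin n → Set
    Exchange a a′ = E a (mA M a′)

    gain : Fin n → Fin n → ℤ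
    gain a a′ = wtℤ M a (mA M a′)

    exchange : (π : Permutation′ n) → (∀ a → Exchange a (π ⟨$⟩ʳ a)) → PerfectMatching G
    exchange π edges = record
      { mA  = mA M ∘ (π ⟨$⟩ʳ_)
      ; mB  = (π ⟨$⟩ˡ_) ∘ mB M
      ; mBA = λ a → trans (cong (π ⟨$⟩ˡ_) (mBA M (π ⟨$⟩ʳ a))) (Perm.inverseˡ π)
      ; mAB = λ b → trans (cong (mA M) (Perm.inverseʳ π)) (mAB M b)
      ; inE = edges
      }

    votes-exchange : ∀ π edges a →
      voteA (exchange π edges) M a + voteB (exchange π edges) M (mA M (π ⟨$⟩ʳ a)) ≡ gain a (π ⟨$⟩ʳ a)
    votes-exchange π edges a rewrite mBA M (π ⟨$⟩ʳ a) | Perm.inverseˡ π {a} =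
      votes (compare _ _) (compare _ _) fixed-by-A fixed-by-B
      where
      b = mA M (π ⟨$⟩ʳ a)
      fixed-by-A : rankA a b ≡ rankA a (mA M a) → rankB b a ≡ rankB b (π ⟨$⟩ʳ a)
      fixed-by-A eq = cong (rankB b) (sym (begin
        π ⟨$⟩ʳ a              ≡⟨ mBA M (π ⟨$⟩ʳ a) ⟨
        mB M b                ≡⟨ cong (mB M) (strictA a b (mA M a) (edges a) (inE M a) eq) ⟩
        mB M (mA M a)         ≡⟨ mBA M a ⟩
        a                     ∎))
        where open ≡-Reasoning
      fixed-by-B : rankB b a ≡ rankB b (π ⟨$⟩ʳ a) → rankA a b ≡ rankA a (mA M a)
      fixed-by-B eq = cong (rankA a ∘ mA M)
        (sym (strictB b a (π ⟨$⟩ʳ a) (edges a) (inE M (π ⟨$⟩ʳ a)) eq))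

    Δ-exchange : ∀ π edges → let N = exchange π edges in
                 + φ G N M - + φ G M N ≡ sum (λ a → gain a (π ⟨$⟩ʳ a))
    Δ-exchange π edges = begin
      + φ G N M - + φ G M N                                     ≡⟨ Δ≡sum-votes N M ⟩
      sum (voteA N M) + sum (voteB N M)                         ≡⟨ cong (λ t → sum (voteA N M) + t)
                                                                     (∑-permute (voteB N M) (π ∘ₚ asPermutation M)) ⟩
      sum (voteA N M) + sum (λ a → voteB N M (mA M (π ⟨$⟩ʳ a))) ≡⟨ ∑-distrib-+ (voteA N M) _ ⟨
      sum (λ a → voteA N M a + voteB N M (mA M (π ⟨$⟩ʳ a)))     ≡⟨ sum-cong-≗ (votes-exchange π edges) ⟩
      sum (λ a → gain a (π ⟨$⟩ʳ a))                             ∎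
      where
      open ≡-Reasoning
      N = exchange π edges

    popular⇒exchanges≤0 : Popular G M → ∀ π → (∀ a → Exchange a (π ⟨$⟩ʳ a)) →
                           sum (λ a → gain a (π ⟨$⟩ʳ a)) ≤ + 0
    popular⇒exchanges≤0 popular π edges =
      subst (_≤ + 0) (Δ-exchange π edges) (ℤP.i≤j⇒i-j≤0 (ℤ.+≤+ (popular (exchange π edges))))

    gain-refl : ∀ a → gain a a ≡ + 0
    gain-refl a rewrite mBA M a = weight-tie (rankA a (mA M a)) (rankB (mA M a) a)

    open WeightedDigraph Exchange gain

    popular⇒¬¬potential : Popular G M → DoubleNegation (∃ IsPotential)
    popular⇒¬¬potential popular =
      ¬¬-potential
        (nonpositive-exchanges⇒NoPositiveCycle (inE M) gain-refl (popular⇒exchanges≤0 popular))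
        2 (λ a a′ → wtℤ≤2 M a (mA M a′))

  sumℚ-toℚ : ∀ {k} {g : Fin k → ℚ} (f : Fin k → ℤ) → (∀ i → g i ≡ toℚ (f i)) →
             sumℚ G g ≡ toℚ (sum f)
  sumℚ-toℚ {zero}  f g≡f = refl
  sumℚ-toℚ {suc k} f g≡f = trans (cong₂ ℚ._+_ (g≡f zero) (sumℚ-toℚ (f ∘ suc) (g≡f ∘ suc)))
                                 (sym (toℚ-+ (f zero) (sum (f ∘ suc))))

  Objective-toℚ : ∀ {zA zB : Fin n → ℚ} (yA yB : Fin n → ℤ) →
                  (∀ a → zA a ≡ toℚ (yA a)) → (∀ b → zB b ≡ toℚ (yB b)) →
                  Objective G zA zB ≡ toℚ (sum yA + sum yB)
  Objective-toℚ yA yB zA≡ zB≡ =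
    trans (cong₂ ℚ._+_ (sumℚ-toℚ yA zA≡) (sumℚ-toℚ yB zB≡)) (sym (toℚ-+ (sum yA) (sum yB)))

  dualA dualB : (Fin n → Fin n) → Fin n → ℤ
  dualA ia a = - + (2 ℕ.* toℕ (ia a))
  dualB jb b = + (2 ℕ.* toℕ (jb b))

  αA≡toℚ : ∀ ia a → αA G ia a ≡ toℚ (dualA ia a)
  αA≡toℚ ia a = sym (toℚ-neg (+ (2 ℕ.* toℕ (ia a))))

  module _ (M : PerfectMatching G) (ia jb : Fin n → Fin n) where

    feasibleℤ : Feasible G M (αA G ia) (αB G jb) → ∀ a b → E a b → wtℤ M a b ≤ dualA ia a + dualB jb b
    feasibleℤ feasible a b e = toℚ-cancel-≤ (subst₂ ℚ._≤_ (wt≡toℚ-wtℤ M a b)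
      (trans (cong (ℚ._+ αB G jb b) (αA≡toℚ ia a)) (sym (toℚ-+ (dualA ia a) (dualB jb b))))
      (feasible a b e))

    open ExchangeGraph M
    open WeightedDigraph Exchange gain using (IsPotential)

    potential-dual-feasible : ∀ {p} → IsPotential p → Feasible G M (toℚ ∘ -_ ∘ p) (toℚ ∘ p ∘ mB M)
    potential-dual-feasible {p} potential a b e =
      subst₂ ℚ._≤_ (sym (wt≡toℚ-wtℤ M a b)) (toℚ-+ (- p a) (p (mB M b))) (toℚ-mono-≤ (begin
        wtℤ M a b                  ≡⟨ cancel (p a) (wtℤ M a b) ⟩
        - p a + (p a + wtℤ M a b)  ≤⟨ ℤP.+-monoʳ-≤ (- p a) shifted ⟩
        - p a + p (mB M b)         ∎))
      where
      open ℤP.≤-Reasoning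
      cancel : ∀ x y → y ≡ - x + (x + y)
      cancel = solve-∀
      shifted : p a + wtℤ M a b ≤ p (mB M b)
      shifted = subst (λ b′ → p a + wtℤ M a b′ ≤ p (mB M b)) (mAB M b)
                      (potential a (mB M b) (subst (E a) (sym (mAB M b)) e))

    potential-dual-objective : ∀ p → Objective G (toℚ ∘ -_ ∘ p) (toℚ ∘ p ∘ mB M) ≡ toℚ (+ 0)
    potential-dual-objective p = trans (Objective-toℚ (-_ ∘ p) (p ∘ mB M) (λ _ → refl) (λ _ → refl))
      (cong toℚ (begin
        sum (-_ ∘ p) + sum (p ∘ mB M) ≡⟨ cong₂ _+_ (sum-neg p) (sym (∑-permute p π⁻¹)) ⟩
        - sum p + sum p               ≡⟨ ℤP.+-inverseˡ (sum p) ⟩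
        + 0                           ∎))
      where
      open ≡-Reasoning
      π⁻¹ = Perm.flip (asPermutation M)

    slack : Fin n → ℤ
    slack a = dualA ia a + dualB jb (mA M a)

    Objective-α : Objective G (αA G ia) (αB G jb) ≡ toℚ (sum slack)
    Objective-α = trans (Objective-toℚ (dualA ia) (dualB jb) (αA≡toℚ ia) (λ _ → refl)) (cong toℚ (begin
      sum (dualA ia) + sum (dualB jb)        ≡⟨ cong (λ t → sum (dualA ia) + t) (∑-permute (dualB jb) π) ⟩
      sum (dualA ia) + sum (dualB jb ∘ mA M) ≡⟨ ∑-distrib-+ (dualA ia) (dualB jb ∘ mA M) ⟨
      sum slack                              ∎))
      where
      open ≡-Reasoning
      π = asPermutation M

    module _ (optimal : OptimalLP G M (αA G ia) (αB G jb)) where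

      slack≥0 : ∀ a → + 0 ≤ slack a
      slack≥0 a = subst (_≤ slack a) (gain-refl a) (feasibleℤ (proj₁ optimal) a (mA M a) (inE M a))

      sum-slack≤0 : Popular G M → sum slack ≤ + 0
      sum-slack≤0 popular = decidable-stable (sum slack ℤP.≤? + 0)
        (¬¬-map (λ (p , potential) → toℚ-cancel-≤ (subst₂ ℚ._≤_ Objective-α (potential-dual-objective p)
                   (proj₂ optimal _ _ (potential-dual-feasible potential))))
                (popular⇒¬¬potential popular))

      tight : Popular G M → ∀ a → jb (mA M a) ≡ ia a
      tight popular a = Fin.toℕ-injective (ℕP.*-cancelˡ-≡ _ _ 2 (ℤP.+-injective
        (ℤP.i-j≡0⇒i≡j _ _ (trans (ℤP.+-comm _ (dualA ia a))
                                 (nonneg-sum≤0⇒≡0 slack≥0 (sum-slack≤0 popular) a)))))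

-- Stability of S

dual-gap≤ : ∀ i j c → c ℕ.+ j ℕ.≤ i → - + (2 ℕ.* i) + + (2 ℕ.* j) ≤ - + (2 ℕ.* c)
dual-gap≤ i j c c+j≤i = begin
  - + (2 ℕ.* i) + + (2 ℕ.* j)                 ≤⟨ ℤP.+-monoˡ-≤ (+ (2 ℕ.* j)) (ℤP.neg-mono-≤ (ℤ.+≤+ 2c+2j≤2i)) ⟩
  - + (2 ℕ.* (c ℕ.+ j)) + + (2 ℕ.* j)         ≡⟨ cong (λ t → - t + + (2 ℕ.* j)) 2[c+j]≡2c+2j ⟩
  - (+ (2 ℕ.* c) + + (2 ℕ.* j)) + + (2 ℕ.* j) ≡⟨ cancel (+ (2 ℕ.* c)) (+ (2 ℕ.* j)) ⟩
  - + (2 ℕ.* c)                               ∎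
  where
  open ℤP.≤-Reasoning
  2c+2j≤2i : 2 ℕ.* (c ℕ.+ j) ℕ.≤ 2 ℕ.* i
  2c+2j≤2i = ℕP.*-monoʳ-≤ 2 c+j≤i
  2[c+j]≡2c+2j : + (2 ℕ.* (c ℕ.+ j)) ≡ + (2 ℕ.* c) + + (2 ℕ.* j)
  2[c+j]≡2c+2j = trans (cong +_ (ℕP.*-distribˡ-+ 2 c j)) (ℤP.pos-+ (2 ℕ.* c) (2 ℕ.* j))
  cancel : ∀ x y → - (x + y) + y ≡ - x
  cancel = solve-∀

suc<⇒<∸1 : ∀ {m} x → suc x ℕ.< m → x ℕ.< m ℕ.∸ 1
suc<⇒<∸1 {suc m} x (s≤s x<m) = x<m

<∸1⇒suc< : ∀ {m} x → x ℕ.< m ℕ.∸ 1 → suc x ℕ.< m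
<∸1⇒suc< {suc m} x x<m = s≤s x<m

module _ {n : ℕ} (G : Graph n) (M : PerfectMatching G) (ia jb : Fin n → Fin n)
         (tight : ∀ a → jb (mA M a) ≡ ia a)
         (feasible : ∀ a b → Graph.E G a b → wtℤ G M a b ≤ dualA G ia a + dualB G jb b) where
  open Graph G

  private
    S = SMatch G M ia jb

  S⊆EStar : ∀ x y → S x y → EStar G x y
  S⊆EStar _ _ (s-M {a} {b} {i} Ma≡b _ _) = e-tl i (subst (E a) Ma≡b (inE M a))
  S⊆EStar _ _ (s-D1 {a} {j} k j≡k _)    = e-dl a j k j≡k
  S⊆EStar _ _ (s-D2 {a} {j} k j≡k+1 _)  = e-dr a j k j≡k+1

  S-functional : ∀ x y y′ → S x y → S x y′ → y ≡ y′
  S-functional _ _ _ (s-M Ma≡b _ _)    (s-M Ma≡b′ _ _)    = cong tl (trans (sym Ma≡b) Ma≡b′)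
  S-functional _ _ _ (s-M _ refl _)    (s-D1 _ _ i<i)     = contradiction i<i (ℕP.<-irrefl refl)
  S-functional _ _ _ (s-M _ refl _)    (s-D2 _ _ i<i)     = contradiction i<i (ℕP.<-irrefl refl)
  S-functional _ _ _ (s-D1 _ _ i<i)    (s-M _ refl _)     = contradiction i<i (ℕP.<-irrefl refl)
  S-functional _ _ _ (s-D2 _ _ i<i)    (s-M _ refl _)     = contradiction i<i (ℕP.<-irrefl refl)
  S-functional _ _ _ (s-D1 {a} _ j≡k _) (s-D1 _ j≡k′ _)   =
    cong (d a) (Fin.toℕ-injective (trans (sym j≡k) j≡k′))
  S-functional _ _ _ (s-D2 {a} _ j≡k _) (s-D2 _ j≡k′ _)   =
    cong (d a) (Fin.toℕ-injective (ℕP.suc-injective (trans (sym j≡k) j≡k′)))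
  S-functional _ _ _ (s-D1 _ _ j<i)    (s-D2 _ _ i<j)     = contradiction i<j (ℕP.<-asym j<i)
  S-functional _ _ _ (s-D2 _ _ i<j)    (s-D1 _ _ j<i)     = contradiction i<j (ℕP.<-asym j<i)

  S-injective : ∀ x x′ y → S x y → S x′ y → x ≡ x′
  S-injective _ _ _ (s-M {a} Ma≡b _ jb≡i) (s-M {a′} Ma′≡b _ jb≡i′) =
    cong₂ _,_ (trans (sym (mBA M a)) (trans (cong (mB M) (trans Ma≡b (sym Ma′≡b))) (mBA M a′)))
              (trans (sym jb≡i) jb≡i′)
  S-injective _ _ _ (s-D1 {a} _ j≡k _) (s-D1 _ j′≡k _) =
    cong (a ,_) (Fin.toℕ-injective (trans j≡k (sym j′≡k)))
  S-injective _ _ _ (s-D2 {a} _ j≡k _) (s-D2 _ j′≡k _) =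
    cong (a ,_) (Fin.toℕ-injective (trans j≡k (sym j′≡k)))
  S-injective _ _ _ (s-D1 _ j≡k j<i) (s-D2 _ j′≡k+1 i<j′) =
    contradiction (subst (ℕ._< _) j≡k j<i) (ℕP.≤⇒≯ (ℕ.s≤s⁻¹ (subst (_ ℕ.<_) j′≡k+1 i<j′)))
  S-injective _ _ _ (s-D2 _ j≡k+1 i<j) (s-D1 _ j′≡k j′<i) =
    contradiction (subst (ℕ._< _) j′≡k j′<i) (ℕP.≤⇒≯ (ℕ.s≤s⁻¹ (subst (_ ℕ.<_) j≡k+1 i<j)))

  A*-matched : ∀ a j → Σ (BStar G) (S (a , j))
  A*-matched a j with ℕP.<-cmp (toℕ j) (toℕ (ia a))
  ... | tri< j<i _ _ =
    let j<n-1 = suc<⇒<∸1 (toℕ j) (ℕP.<-≤-trans (s≤s j<i) (Fin.toℕ<n (ia a)))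
    in d a (fromℕ< j<n-1) , s-D1 (fromℕ< j<n-1) (sym (Fin.toℕ-fromℕ< j<n-1)) j<i
  ... | tri≈ _ j≡i _ =
    let ia≡j = Fin.toℕ-injective (sym j≡i)
    in tl (mA M a) , s-M refl ia≡j (trans (tight a) ia≡j)
  ... | tri> _ _ i<j with toℕ j in j≡
  ...   | suc m =
    let m<n-1 = suc<⇒<∸1 m (subst (ℕ._< n) j≡ (Fin.toℕ<n j))
    in d a (fromℕ< m<n-1) , s-D2 (fromℕ< m<n-1) (trans j≡ (cong suc (sym (Fin.toℕ-fromℕ< m<n-1))))
                                    (subst (toℕ (ia a) ℕ.<_) (sym j≡) i<j)

  B*-matched : ∀ y → Σ (AStar G) (λ x → S x y)
  B*-matched (tl b) = (mB M b , ia (mB M b)) , s-M (mAB M b) refl (trans (cong jb (sym (mAB M b))) (tight (mB M b)))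
  B*-matched (d a k) with toℕ k <? toℕ (ia a)
  ... | yes k<i =
    let k<n = ℕP.<-≤-trans (Fin.toℕ<n k) (ℕP.m∸n≤m n 1)
    in (a , fromℕ< k<n) , s-D1 k (Fin.toℕ-fromℕ< k<n) (subst (ℕ._< toℕ (ia a)) (sym (Fin.toℕ-fromℕ< k<n)) k<i)
  ... | no  k≮i =
    let k+1<n = <∸1⇒suc< (toℕ k) (Fin.toℕ<n k)
    in (a , fromℕ< k+1<n) , s-D2 k (Fin.toℕ-fromℕ< k+1<n)
                               (subst (toℕ (ia a) ℕ.<_) (sym (Fin.toℕ-fromℕ< k+1<n)) (s≤s (ℕP.≮⇒≥ k≮i)))

  private
    gap≤-2 : ∀ a b → toℕ (jb b) ℕ.< toℕ (ia a) → dualA G ia a + dualB G jb b ≤ -[1+ 1 ]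
    gap≤-2 a b = dual-gap≤ (toℕ (ia a)) (toℕ (jb b)) 1

    gap≤-4 : ∀ a b → 2 ℕ.+ toℕ (jb b) ℕ.≤ toℕ (ia a) → dualA G ia a + dualB G jb b ≤ -[1+ 3 ]
    gap≤-4 a b = dual-gap≤ (toℕ (ia a)) (toℕ (jb b)) 2

    gap≡0 : ∀ a b → ia a ≡ jb b → dualA G ia a + dualB G jb b ≡ + 0
    gap≡0 a b ia≡jb rewrite ia≡jb = ℤP.+-inverseˡ (dualB G jb b)

    partner-of : ∀ {a b} → mA M a ≡ b → mB M b ≡ a
    partner-of {a} refl = mBA M a

  no-blocking-tl : ∀ a b i → E a b →
                   ∀ z → S (a , i) z → PrefA G (a , i) (tl b) z →
                   ∀ w → S w (tl b) → PrefB G (tl b) (a , i) w → ⊥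
  no-blocking-tl a b i e _ (s-M refl ia≡i _) (p-tl-tl a-prefers) _ (s-M _ _ jb≡j) (p-sub j<i) =
    ℕP.<-asym a-prefers (proj₁ (wtℤ≤-2⇒dominated G M a b (ℤP.≤-trans (feasible a b e)
      (gap≤-2 a b (subst₂ ℕ._<_ (cong toℕ (sym jb≡j)) (cong toℕ (sym ia≡i)) j<i)))))
  no-blocking-tl a b i e _ (s-M refl ia≡i _) (p-tl-tl a-prefers) _ (s-M Ma″≡b _ jb≡i) (p-same b-prefers) =
    contradiction
      (subst₂ _≤_ (wtℤ-blocking G M a b a-prefers (subst ((rankB b a ℕ.<_) ∘ rankB b) (sym (partner-of Ma″≡b)) b-prefers))
                  (gap≡0 a b (trans ia≡i (sym jb≡i)))
                  (feasible a b e))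
      (λ { (ℤ.+≤+ ()) })
  no-blocking-tl a b i e _ (s-D1 _ _ i<ia) (p-tl-bot _ _) _ (s-M _ _ jb≡j) (p-sub j<i) =
    contradiction
      (ℤP.≤-trans (-2≤wtℤ G M a b) (ℤP.≤-trans (feasible a b e)
        (gap≤-4 a b (ℕP.<-≤-trans (s≤s (subst (ℕ._< toℕ i) (cong toℕ (sym jb≡j)) j<i)) i<ia))))
      (λ { (ℤ.-≤- (s≤s ())) })
  no-blocking-tl a b i e _ (s-D1 _ _ i<ia) (p-tl-bot _ _) _ (s-M Ma″≡b _ jb≡i) (p-same b-prefers) =
    ℕP.<-asym (subst ((rankB b a ℕ.<_) ∘ rankB b) (sym (partner-of Ma″≡b)) b-prefers)
      (proj₂ (wtℤ≤-2⇒dominated G M a b (ℤP.≤-trans (feasible a b e)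
        (gap≤-2 a b (subst (ℕ._< toℕ (ia a)) (cong toℕ (sym jb≡i)) i<ia)))))
  no-blocking-tl a b i e _ (s-D2 _ i≡k+1 _) (p-tl-bot _ i≡k) _ _ _ =
    ℕP.<-irrefl (trans (sym i≡k) i≡k+1) (ℕP.n<1+n _)

  no-blocking : ∀ x y → ¬ BlocksStar G S x y
  no-blocking (a , i) y (_ , inj₁ unmatched , _) = unmatched _ (proj₂ (A*-matched a i))
  no-blocking x y (_ , _ , inj₁ unmatched) = unmatched _ (proj₂ (B*-matched y))
  no-blocking (a , i) (tl b) (e-tl i e , inj₂ (z , sz , a-prefers) , inj₂ (w , sw , b-prefers)) =
    no-blocking-tl a b i e z sz a-prefers w sw b-prefers
  no-blocking (a , i) (d a k) (e-dl a i k i≡k , inj₂ (_ , _ , p-top-tl k i≡k+1) , _) =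
    ℕP.<-irrefl (trans (sym i≡k) i≡k+1) (ℕP.n<1+n _)
  no-blocking (a , i) (d a k) (e-dl a i k i≡k , inj₂ (_ , _ , p-top-bot k _ i≡k+1 _) , _) =
    ℕP.<-irrefl (trans (sym i≡k) i≡k+1) (ℕP.n<1+n _)
  no-blocking (a , i) (d a k) (e-dr a i k i≡k+1 , _ , inj₂ (_ , _ , p-d i≡k _)) =
    ℕP.<-irrefl (trans (sym i≡k) i≡k+1) (ℕP.n<1+n _)

  SMatch-stable : StableStar G S
  SMatch-stable = (S⊆EStar , S-functional , S-injective) , no-blocking

theorem4 : (n : ℕ) (G : Graph n) (M : PerfectMatching G) →
    Popular G M →
    (ia jb : Fin n → Fin n) →
    OptimalLP G M (αA G ia) (αB G jb) →
    StableStar G (SMatch G M ia jb)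
theorem4 n G M popular ia jb optimal =
  SMatch-stable G M ia jb (tight G M ia jb optimal popular) (feasibleℤ G M ia jb (proj₁ optimal))
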